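{- For a real number $a$ and a nonnegative integer $n$ let $(a)_n=a(a+1)(a+2)\cdots(a+n-1)$ (with $(a)_0=1$). (a) Let $p$ be a prime with $p\equiv 1\pmod 4$ and define $$s_n=64^n\frac{\left(\frac14\right)_n^2}{(1)_n^2}.$$ Then for every positive integer $n$, $s_{np}\equiv s_n \pmod{p^2}$. (b) Let $p$ be a prime with $p\equiv 1\pmod 6$ and define $$t_n=108^n\frac{\left(\frac16\right)_n\left(\frac13\right)_n}{(1)_n^2}.$$ Then for every positive integer $n$, $t_{np}\equiv t_n\pmod{p^2}$.
   Context: The numbers $s_n$ and $t_n$ are rational numbers (in fact integers). For rational numbers $x,y$ whose denominators are prime to $p$, $x\equiv y\pmod{p^k}$ means that $x-y$, written in lowest terms, has numerator divisible by $p^k$. -}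

module Defs where

open import Data.Nat as ℕ using (ℕ; zero; suc; _!; _^_)
open import Data.Nat.Properties using (_!≢0; _!*_!≢0)
open import Data.Nat.Coprimality using (Coprime)
open import Data.Integer as ℤ using (ℤ; +_)
open import Data.Integer.Divisibility using () renaming (_∣_ to _∣ℤ_)
open import Data.Rational using (ℚ; 1ℚ; _+_; _*_; _-_; _/_; ↥_; ↧ₙ_)
open import Data.Product using (_×_)

poch : ℚ → ℕ → ℚ
poch a zero    = 1ℚ
poch a (suc n) = poch a n * (a + (+ n / 1))

ℕ→ℚ : ℕ → ℚ
ℕ→ℚ n = + n / 1

-- 1 / ((1)_n)^2, using (1)_n = n!
inv1sq : ℕ → ℚ
inv1sq n = (+ 1 / (n ! ℕ.* n !)) {{n !* n !≢0}}

s : ℕ → ℚ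
s n = ℕ→ℚ (64 ^ n) * (poch (+ 1 / 4) n * poch (+ 1 / 4) n) * inv1sq n

t : ℕ → ℚ
t n = ℕ→ℚ (108 ^ n) * (poch (+ 1 / 6) n * poch (+ 1 / 3) n) * inv1sq n

_≡_[modpow_,_] : ℚ → ℚ → ℕ → ℕ → Set
x ≡ y [modpow p , k ] =
  Coprime (↧ₙ x) p × Coprime (↧ₙ y) p × (+ (p ^ k) ∣ℤ (↥ (x - y)))

module Submission where

-- Since (1/d)_n = ∏_{k<n} (d k + 1) / d^n, both sequences are fractions N n / n!².  For
-- p ≡ 1 (mod d), cutting ∏_{k<np} (d k + 1) into n runs of p consecutive factors, each run
-- contains exactly one multiple of p, and  ∏_{k<np} (d k + 1) = p^n ∏_{k<n} (d k + 1) ∏_j B(j)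
-- with p-adic units B(j) (module Block); likewise for (np)!.  So s_{np} = s_n ∏ x_j / ∏ y_j, and
-- the general lemma DworkCongruence turns  x_j ≡ y_j (mod p²)  into the theorem (it also shows
-- that the denominators of s_n are prime to p).  The block congruences come from pairing the
-- factors of a block as  x + y ≡ 0 (mod p)  (PairedBlock, FactorialBlock: periodicity in j and
-- comparison with the reflected progression), together with exact Gauss-type identities
-- obtained by computing (4p)!, (3p)! and ∏_{k<2p} (3k + 1) in two ways (PartA, PartB).

open import Defs
open import Data.Nat using (ℕ; suc; _*_; _%_; _≤_)
open import Data.Nat.Primality using (Prime)
open import Relation.Binary.PropositionalEquality using (_≡_)
open import Data.Product using (_×_)

open import Data.Nat using (zero; _+_; _^_; _∸_; _<_; _!; pred; z<s; s≤s; NonZero; >-nonZero; nonTrivial⇒n>1)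
open import Data.Nat.Properties
open import Data.Nat.Divisibility
  using (_∣_; _∤_; divides; ∣-trans; m∣m*n; n∣m*n; ∣n⇒∣m*n; ∣m+n∣m⇒∣n; >⇒∤; *-monoˡ-∣; *-cancelʳ-∣)
open import Data.Product using (∃-syntax; _,_)
open import Data.Sum using (inj₁; inj₂; [_,_]′)
open import Data.Empty using (⊥-elim)
open import Data.Nat.Primality using (euclidsLemma; prime⇒nonZero; prime⇒nonTrivial; prime⇒irreducible)
open import Data.Nat.Coprimality using (Coprime; coprime-divisor)
open import Data.Nat.DivMod using (_/_; m≡m%n+[m/n]*n; m%n<n; m/n<m)
open import Data.Nat.Induction using (<-rec)
import Data.Nat.Coprimality as Coprime
open import Data.Integer as ℤ using (ℤ; _⊖_)
import Data.Integer.Properties as ℤ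
import Data.Integer.Tactic.RingSolver as ℤ-Solver
open import Data.Rational as ℚ using (ℚ; mkℚ; ↥_; ↧_; ↧ₙ_)
import Data.Rational.Properties as ℚ
open import Data.Rational.Unnormalised as ℚᵘ using (mkℚᵘ; *≡*) renaming (_≃_ to _≃ᵘ_)
import Data.Rational.Unnormalised.Properties as ℚᵘ
open import Relation.Binary.Bundles using (Setoid)
import Relation.Binary.Reasoning.Setoid as SetoidReasoning
open import Relation.Binary.PropositionalEquality
  using (refl; sym; trans; cong; cong₂; subst; subst₂; module ≡-Reasoning)
open import Data.Nat.Tactic.RingSolver using (solve-∀)

prod : ℕ → (ℕ → ℕ) → ℕ
prod zero    f = 1
prod (suc n) f = prod n f * f n

module _ where
  open ≡-Reasoning

  prod-cong : ∀ n {f g : ℕ → ℕ} → (∀ i → i < n → f i ≡ g i) → prod n f ≡ prod n g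
  prod-cong zero    f≡g = refl
  prod-cong (suc n) f≡g =
    cong₂ _*_ (prod-cong n (λ i i<n → f≡g i (m<n⇒m<1+n i<n))) (f≡g n ≤-refl)

  prod-+ : ∀ m n (f : ℕ → ℕ) → prod (m + n) f ≡ prod m f * prod n (λ i → f (m + i))
  prod-+ m zero    f = trans (cong (λ k → prod k f) (+-identityʳ m)) (sym (*-identityʳ _))
  prod-+ m (suc n) f = begin
    prod (m + suc n) f                                ≡⟨ cong (λ k → prod k f) (+-suc m n) ⟩
    prod (m + n) f * f (m + n)                        ≡⟨ cong (_* f (m + n)) (prod-+ m n f) ⟩
    prod m f * prod n (λ i → f (m + i)) * f (m + n)   ≡⟨ *-assoc (prod m f) _ _ ⟩
    prod m f * prod (suc n) (λ i → f (m + i))         ∎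

  prod-head : ∀ n (f : ℕ → ℕ) → prod (suc n) f ≡ f 0 * prod n (λ i → f (suc i))
  prod-head n f = trans (prod-+ 1 n f) (cong (_* prod n (λ i → f (suc i))) (*-identityˡ (f 0)))

  prod-skip : ∀ m n (f : ℕ → ℕ) →
              prod (m + suc n) f ≡ f m * (prod m f * prod n (λ i → f (m + suc i)))
  prod-skip m n f = begin
    prod (m + suc n) f                                        ≡⟨ prod-+ m (suc n) f ⟩
    prod m f * prod (suc n) (λ i → f (m + i))                 ≡⟨ cong (prod m f *_) (prod-head n (λ i → f (m + i))) ⟩
    prod m f * (f (m + 0) * prod n (λ i → f (m + suc i)))     ≡⟨ cong (λ k → prod m f * (f k * prod n (λ i → f (m + suc i)))) (+-identityʳ m) ⟩
    prod m f * (f m * prod n (λ i → f (m + suc i)))           ≡⟨ x*[y*z]≡y*[x*z] (prod m f) (f m) _ ⟩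
    f m * (prod m f * prod n (λ i → f (m + suc i)))           ∎
    where
    x*[y*z]≡y*[x*z] : ∀ x y z → x * (y * z) ≡ y * (x * z)
    x*[y*z]≡y*[x*z] = solve-∀

  prod-* : ∀ n (f g : ℕ → ℕ) → prod n (λ i → f i * g i) ≡ prod n f * prod n g
  prod-* zero    f g = refl
  prod-* (suc n) f g = begin
    prod n (λ i → f i * g i) * (f n * g n) ≡⟨ cong (_* (f n * g n)) (prod-* n f g) ⟩
    prod n f * prod n g * (f n * g n)      ≡⟨ interchange (prod n f) (prod n g) (f n) (g n) ⟩
    prod n f * f n * (prod n g * g n)      ∎
    where
    interchange : ∀ a b c d → a * b * (c * d) ≡ a * c * (b * d)
    interchange = solve-∀

  prod-const : ∀ n c → prod n (λ _ → c) ≡ c ^ n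
  prod-const zero    c = refl
  prod-const (suc n) c = trans (cong (_* c) (prod-const n c)) (*-comm (c ^ n) c)

  ^-distribʳ-* : ∀ n a b → (a * b) ^ n ≡ a ^ n * b ^ n
  ^-distribʳ-* n a b = begin
    (a * b) ^ n                                 ≡⟨ prod-const n (a * b) ⟨
    prod n (λ _ → a * b)                        ≡⟨ prod-* n (λ _ → a) (λ _ → b) ⟩
    prod n (λ _ → a) * prod n (λ _ → b)         ≡⟨ cong₂ _*_ (prod-const n a) (prod-const n b) ⟩
    a ^ n * b ^ n                               ∎

  prod-blocks : ∀ n d (f : ℕ → ℕ) → prod (n * d) f ≡ prod n (λ k → prod d (λ i → f (k * d + i)))
  prod-blocks zero    d f = refl
  prod-blocks (suc n) d f = begin
    prod (d + n * d) f                              ≡⟨ cong (λ k → prod k f) (+-comm d (n * d)) ⟩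
    prod (n * d + d) f                              ≡⟨ prod-+ (n * d) d f ⟩
    prod (n * d) f * prod d (λ i → f (n * d + i))   ≡⟨ cong (_* prod d (λ i → f (n * d + i))) (prod-blocks n d f) ⟩
    prod (suc n) (λ k → prod d (λ i → f (k * d + i))) ∎

  double-factorial : ∀ L → prod (L * 2) suc ≡ prod L (λ k → 2 * k + 1) * (2 ^ L * prod L suc)
  double-factorial L = begin
    prod (L * 2) suc                                              ≡⟨ prod-blocks L 2 suc ⟩
    prod L (λ k → 1 * suc (k * 2 + 0) * suc (k * 2 + 1))          ≡⟨ prod-cong L (λ k _ → by-parity k) ⟩
    prod L (λ k → (2 * k + 1) * (2 * suc k))                      ≡⟨ prod-* L (λ k → 2 * k + 1) (λ k → 2 * suc k) ⟩
    prod L (λ k → 2 * k + 1) * prod L (λ k → 2 * suc k)           ≡⟨ cong (prod L (λ k → 2 * k + 1) *_) (prod-* L (λ _ → 2) suc) ⟩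
    prod L (λ k → 2 * k + 1) * (prod L (λ _ → 2) * prod L suc)    ≡⟨ cong (λ z → prod L (λ k → 2 * k + 1) * (z * prod L suc)) (prod-const L 2) ⟩
    prod L (λ k → 2 * k + 1) * (2 ^ L * prod L suc)               ∎
    where
    by-parity : ∀ k → 1 * suc (k * 2 + 0) * suc (k * 2 + 1) ≡ (2 * k + 1) * (2 * suc k)
    by-parity = solve-∀

  triple-factorial : ∀ L → prod (L * 3) suc ≡ prod L (λ k → 3 * k + 1) * (prod L (λ k → 3 * k + 2) * (3 ^ L * prod L suc))
  triple-factorial L = begin
    prod (L * 3) suc                                                         ≡⟨ prod-blocks L 3 suc ⟩
    prod L (λ k → 1 * suc (k * 3 + 0) * suc (k * 3 + 1) * suc (k * 3 + 2))   ≡⟨ prod-cong L (λ k _ → by-residue k) ⟩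
    prod L (λ k → (3 * k + 1) * ((3 * k + 2) * (3 * suc k)))                 ≡⟨ prod-* L (λ k → 3 * k + 1) _ ⟩
    prod L (λ k → 3 * k + 1) * prod L (λ k → (3 * k + 2) * (3 * suc k))     ≡⟨ cong (prod L (λ k → 3 * k + 1) *_) (prod-* L (λ k → 3 * k + 2) (λ k → 3 * suc k)) ⟩
    prod L (λ k → 3 * k + 1) * (prod L (λ k → 3 * k + 2) * prod L (λ k → 3 * suc k))
      ≡⟨ cong (λ z → prod L (λ k → 3 * k + 1) * (prod L (λ k → 3 * k + 2) * z)) (trans (prod-* L (λ _ → 3) suc) (cong (_* prod L suc) (prod-const L 3))) ⟩
    prod L (λ k → 3 * k + 1) * (prod L (λ k → 3 * k + 2) * (3 ^ L * prod L suc)) ∎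
    where
    by-residue : ∀ k → 1 * suc (k * 3 + 0) * suc (k * 3 + 1) * suc (k * 3 + 2) ≡ (3 * k + 1) * ((3 * k + 2) * (3 * suc k))
    by-residue = solve-∀

  n!≡prod : ∀ n → n ! ≡ prod n suc
  n!≡prod zero    = refl
  n!≡prod (suc n) = trans (cong (suc n *_) (n!≡prod n)) (*-comm (suc n) _)

-- Congruence modulo M on ℕ, stated without subtraction:
-- x ≈ y [mod M ] iff x + k M ≡ y + l M for some k, l.
infix 4 _≈_[mod_]
_≈_[mod_] : ℕ → ℕ → ℕ → Set
x ≈ y [mod M ] = ∃[ k ] ∃[ l ] x + k * M ≡ y + l * M

module _ {M : ℕ} where
  open ≡-Reasoning

  ≈-reflexive : ∀ {x y} → x ≡ y → x ≈ y [mod M ]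
  ≈-reflexive refl = 0 , 0 , refl

  ≈-refl : ∀ {x} → x ≈ x [mod M ]
  ≈-refl = ≈-reflexive refl

  ≈-sym : ∀ {x y} → x ≈ y [mod M ] → y ≈ x [mod M ]
  ≈-sym (k , l , e) = l , k , sym e

  ≈-trans : ∀ {x y z} → x ≈ y [mod M ] → y ≈ z [mod M ] → x ≈ z [mod M ]
  ≈-trans {x} {y} {z} (k , l , e) (k′ , l′ , e′) = k + k′ , l + l′ , (begin
    x + (k + k′) * M        ≡⟨ regroup x k k′ M ⟩
    (x + k * M) + k′ * M    ≡⟨ cong (_+ k′ * M) e ⟩
    (y + l * M) + k′ * M    ≡⟨ swap y l k′ M ⟩
    (y + k′ * M) + l * M    ≡⟨ cong (_+ l * M) e′ ⟩
    (z + l′ * M) + l * M    ≡⟨ swap z l′ l M ⟩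
    (z + l * M) + l′ * M    ≡⟨ sym (regroup z l l′ M) ⟩
    z + (l + l′) * M        ∎)
    where
    regroup : ∀ a b c M → a + (b + c) * M ≡ (a + b * M) + c * M
    regroup = solve-∀
    swap : ∀ a b c M → (a + b * M) + c * M ≡ (a + c * M) + b * M
    swap = solve-∀

  ≈-*-cong : ∀ {x y x′ y′} → x ≈ y [mod M ] → x′ ≈ y′ [mod M ] → x * x′ ≈ y * y′ [mod M ]
  ≈-*-cong {x} {y} {x′} {y′} (k , l , e) (k′ , l′ , e′) =
    k * x′ + k′ * x + k * k′ * M , l * y′ + l′ * y + l * l′ * M , (begin
    x * x′ + (k * x′ + k′ * x + k * k′ * M) * M   ≡⟨ expand x x′ k k′ M ⟩
    (x + k * M) * (x′ + k′ * M)                    ≡⟨ cong₂ _*_ e e′ ⟩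
    (y + l * M) * (y′ + l′ * M)                    ≡⟨ sym (expand y y′ l l′ M) ⟩
    y * y′ + (l * y′ + l′ * y + l * l′ * M) * M   ∎)
    where
    expand : ∀ x x′ k k′ M → x * x′ + (k * x′ + k′ * x + k * k′ * M) * M ≡ (x + k * M) * (x′ + k′ * M)
    expand = solve-∀

  ≈-*ˡ : ∀ c {x y} → x ≈ y [mod M ] → c * x ≈ c * y [mod M ]
  ≈-*ˡ c = ≈-*-cong (≈-refl {c})

  ≈-prod : ∀ n {f g : ℕ → ℕ} → (∀ i → i < n → f i ≈ g i [mod M ]) → prod n f ≈ prod n g [mod M ]
  ≈-prod zero    f≈g = ≈-refl
  ≈-prod (suc n) f≈g = ≈-*-cong (≈-prod n (λ i i<n → f≈g i (m<n⇒m<1+n i<n))) (f≈g n ≤-refl)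

  ≈-prod-paired : ∀ L {A B A′ B′ : ℕ → ℕ} →
                  (∀ i t → i + suc t ≡ L → A i * B t ≈ A′ i * B′ t [mod M ]) →
                  prod L A * prod L B ≈ prod L A′ * prod L B′ [mod M ]
  ≈-prod-paired zero    pairs = ≈-refl
  ≈-prod-paired (suc L) {A} {B} {A′} {B′} pairs = ≈-trans (≈-reflexive (peel A B))
    (≈-trans (≈-*-cong (≈-prod-paired L (λ i t e → pairs i (suc t) (trans (+-suc i (suc t)) (cong suc e))))
                       (pairs L 0 (+-comm L 1)))
             (≈-reflexive (sym (peel A′ B′))))
    where
    peel : ∀ (A B : ℕ → ℕ) →
           prod (suc L) A * prod (suc L) B ≡ (prod L A * prod L (λ t → B (suc t))) * (A L * B 0)
    peel A B = begin
      prod L A * A L * prod (suc L) B                        ≡⟨ cong (prod L A * A L *_) (prod-head L B) ⟩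
      prod L A * A L * (B 0 * prod L (λ t → B (suc t)))      ≡⟨ interchange (prod L A) (A L) (B 0) _ ⟩
      prod L A * prod L (λ t → B (suc t)) * (A L * B 0)      ∎
      where
      interchange : ∀ a b c d → a * b * (c * d) ≡ a * d * (b * c)
      interchange = solve-∀

  ≈⇒∣∸ : ∀ {x y} → x ≈ y [mod M ] → M ∣ y ∸ x
  ≈⇒∣∸ {x} {y} (k , l , e) = divides (k ∸ l) (begin
    y ∸ x                        ≡⟨ [m+n]∸[m+o]≡n∸o (l * M) y x ⟨
    (l * M + y) ∸ (l * M + x)    ≡⟨ cong₂ _∸_ (+-comm (l * M) y) (+-comm (l * M) x) ⟩
    (y + l * M) ∸ (x + l * M)    ≡⟨ cong (_∸ (x + l * M)) e ⟨
    (x + k * M) ∸ (x + l * M)    ≡⟨ [m+n]∸[m+o]≡n∸o x (k * M) (l * M) ⟩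
    k * M ∸ l * M                ≡⟨ *-distribʳ-∸ M k l ⟨
    (k ∸ l) * M                  ∎)

  ∣∸⇒≈ : ∀ {x y} → x ≤ y → M ∣ y ∸ x → x ≈ y [mod M ]
  ∣∸⇒≈ {x} {y} x≤y (divides q y∸x≡qM) = q , 0 , (begin
    x + q * M         ≡⟨ cong (x +_) y∸x≡qM ⟨
    x + (y ∸ x)       ≡⟨ m+[n∸m]≡n x≤y ⟩
    y                 ≡⟨ +-identityʳ y ⟨
    y + 0 * M         ∎)

  -- the form in which the congruence reaches integer numerators
  ≈⇒∣⊖∣ : ∀ {x y} → x ≈ y [mod M ] → M ∣ ℤ.∣ x ⊖ y ∣
  ≈⇒∣⊖∣ {x} {y} x≈y with ≤-total x y
  ... | inj₁ x≤y = subst (M ∣_) (sym (ℤ.∣⊖∣-≤ x≤y)) (≈⇒∣∸ x≈y)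
  ... | inj₂ y≤x = subst (M ∣_) (trans (sym (ℤ.∣⊖∣-≤ y≤x)) (ℤ.∣m⊖n∣≡∣n⊖m∣ y x)) (≈⇒∣∸ (≈-sym x≈y))

≈-setoid : ℕ → Setoid _ _
≈-setoid M = record
  { Carrier       = ℕ
  ; _≈_           = _≈_[mod M ]
  ; isEquivalence = record { refl = ≈-refl ; sym = ≈-sym ; trans = ≈-trans }
  }

module ≈-Reasoning (M : ℕ) = SetoidReasoning (≈-setoid M)

-- The two ways in which a pair x + y ≡ 0 (mod p) can be moved without changing
-- its product modulo p².  They drive every "block" congruence below.
module _ (p : ℕ) where
  open ≡-Reasoning

  shift-pair : ∀ K {x y} → p ∣ x + y → (K * p + x) * (K * p + y) ≈ x * y [mod p * p ]
  shift-pair K {x} {y} (divides q x+y≡qp) = 0 , K * (K + q) , (begin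
    (K * p + x) * (K * p + y) + 0 * (p * p)   ≡⟨ expand K p x y ⟩
    x * y + K * p * (K * p + (x + y))         ≡⟨ cong (λ z → x * y + K * p * (K * p + z)) x+y≡qp ⟩
    x * y + K * p * (K * p + q * p)           ≡⟨ collect K p q (x * y) ⟩
    x * y + K * (K + q) * (p * p)             ∎)
    where
    expand : ∀ K p x y → (K * p + x) * (K * p + y) + 0 * (p * p) ≡ x * y + K * p * (K * p + (x + y))
    expand = solve-∀
    collect : ∀ K p q z → z + K * p * (K * p + q * p) ≡ z + K * (K + q) * (p * p)
    collect = solve-∀

  reflect-pair : ∀ {S u v x y} → p ∣ S → u + y ≡ S → v + x ≡ S → p ∣ x + y →
                 u * v ≈ x * y [mod p * p ]
  reflect-pair {S} {u} {v} {x} {y} (divides r S≡rp) u+y≡S v+x≡S (divides q x+y≡qp) =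
    r * q , r * r , (begin
    u * v + r * q * (p * p)                  ≡⟨ pair-up u v r q p ⟩
    u * v + r * p * (q * p)                  ≡⟨ cong₂ (λ a b → u * v + a * b) (sym S≡rp) (sym x+y≡qp) ⟩
    u * v + S * (x + y)                      ≡⟨ cong (u * v +_) (*-distribˡ-+ S x y) ⟩
    u * v + (S * x + S * y)                  ≡⟨ cong₂ (λ a b → u * v + (a * x + b * y)) (sym u+y≡S) (sym v+x≡S) ⟩
    u * v + ((u + y) * x + (v + x) * y)      ≡⟨ complete u v x y ⟩
    (u + y) * (v + x) + x * y                ≡⟨ cong₂ (λ a b → a * b + x * y) u+y≡S v+x≡S ⟩
    S * S + x * y                            ≡⟨ cong (λ a → a * a + x * y) S≡rp ⟩
    r * p * (r * p) + x * y                  ≡⟨ pair-up′ r p (x * y) ⟩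
    x * y + r * r * (p * p)                  ∎)
    where
    pair-up : ∀ u v r q p → u * v + r * q * (p * p) ≡ u * v + r * p * (q * p)
    pair-up = solve-∀
    complete : ∀ u v x y → u * v + ((u + y) * x + (v + x) * y) ≡ (u + y) * (v + x) + x * y
    complete = solve-∀
    pair-up′ : ∀ r p z → r * p * (r * p) + z ≡ z + r * r * (p * p)
    pair-up′ = solve-∀

module PrimeDivisibility {p : ℕ} (p-prime : Prime p) where

  instance
    p-nonZero : NonZero p
    p-nonZero = prime⇒nonZero p-prime

  ∤-* : ∀ {a b} → p ∤ a → p ∤ b → p ∤ a * b
  ∤-* {a} {b} p∤a p∤b p∣ab = [ p∤a , p∤b ]′ (euclidsLemma a b p-prime p∣ab)

  1<p : 1 < p
  1<p = nonTrivial⇒n>1 p {{prime⇒nonTrivial p-prime}}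

  p∤1 : p ∤ 1
  p∤1 = >⇒∤ 1<p

  ∤-prod : ∀ n {f : ℕ → ℕ} → (∀ i → i < n → p ∤ f i) → p ∤ prod n f
  ∤-prod zero    p∤f = p∤1
  ∤-prod (suc n) p∤f = ∤-* (∤-prod n (λ i i<n → p∤f i (m<n⇒m<1+n i<n))) (p∤f n ≤-refl)

  ∤-residue : ∀ K {x} → 0 < x → x < p → p ∤ K * p + x
  ∤-residue K 0<x x<p p∣Kp+x = >⇒∤ {{>-nonZero 0<x}} x<p (∣m+n∣m⇒∣n p∣Kp+x (n∣m*n K))

  ∤⇒nonZero : ∀ {b} → p ∤ b → NonZero b
  ∤⇒nonZero {zero}  p∤0 = ⊥-elim (p∤0 (divides 0 refl))
  ∤⇒nonZero {suc b} _   = _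

  -- The only divisors of p are 1 and p, so a common divisor of b and p divides 1.
  ∤⇒coprime : ∀ {b} → p ∤ b → Coprime b p
  ∤⇒coprime p∤b {c} (c∣b , c∣p) with prime⇒irreducible p-prime c∣p
  ... | inj₁ c≡1 = c≡1
  ... | inj₂ refl = ⊥-elim (p∤b c∣b)

  p²-cancel : ∀ {a b} → p ∤ b → p * p ∣ a * b → p * p ∣ a
  p²-cancel {a} {b} p∤b p²∣ab with euclidsLemma a b p-prime (∣-trans (m∣m*n p) p²∣ab)
  ... | inj₂ p∣b = ⊥-elim (p∤b p∣b)
  ... | inj₁ (divides q refl) = *-monoˡ-∣ p p∣q
    where
    p∣qb : p ∣ q * b
    p∣qb = *-cancelʳ-∣ p (subst (p * p ∣_) (rearrange q p b) p²∣ab)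
      where
      rearrange : ∀ q p b → q * p * b ≡ q * b * p
      rearrange = solve-∀
    p∣q : p ∣ q
    p∣q = [ (λ p∣q → p∣q) , (λ p∣b → ⊥-elim (p∤b p∣b)) ]′ (euclidsLemma q b p-prime p∣qb)

  ≈-cancel : ∀ {x y w} → p ∤ w → x * w ≈ y * w [mod p * p ] → x ≈ y [mod p * p ]
  ≈-cancel {x} {y} {w} p∤w xw≈yw with ≤-total x y
  ... | inj₁ x≤y = ∣∸⇒≈ x≤y (p²-cancel p∤w (subst (p * p ∣_) (sym (*-distribʳ-∸ w y x)) (≈⇒∣∸ xw≈yw)))
  ... | inj₂ y≤x = ≈-sym (∣∸⇒≈ y≤x (p²-cancel p∤w (subst (p * p ∣_) (sym (*-distribʳ-∸ w x y)) (≈⇒∣∸ (≈-sym xw≈yw)))))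

-- Let p = m + 1 + n and let the progression
-- k ↦ d k + r hit the multiple c p at k = m.  The factors with index in
-- [K' p, (K' + 1) p) are  K p + (d i + r)  (i < p) with K = d K', and removing
-- the one divisible by p leaves the block  block K.  These blocks are the
-- p-adic units into which products like  ∏_{k < N p} (d k + 1)  decompose.
module Block (d r m n c p : ℕ) (m+1+n≡p : m + suc n ≡ p) (middle : d * m + r ≡ c * p) where
  open ≡-Reasoning

  term : ℕ → ℕ
  term k = d * k + r

  block : ℕ → ℕ
  block K = prod m (λ i → K * p + term i) * prod n (λ i → K * p + term (m + suc i))

  segment : ∀ K → prod p (λ i → K * p + term i) ≡ p * (K + c) * block K
  segment K = begin
    prod p f                                      ≡⟨ cong (λ L → prod L f) (sym m+1+n≡p) ⟩
    prod (m + suc n) f                            ≡⟨ prod-skip m n f ⟩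
    (K * p + (d * m + r)) * block K               ≡⟨ cong (λ z → (K * p + z) * block K) middle ⟩
    (K * p + c * p) * block K                     ≡⟨ cong (_* block K) (factor K c p) ⟩
    p * (K + c) * block K                         ∎
    where
    f : ℕ → ℕ
    f i = K * p + term i
    factor : ∀ K c p → K * p + c * p ≡ p * (K + c)
    factor = solve-∀

  blocks : ∀ N → prod (N * p) term ≡ p ^ N * prod N (λ j → d * j + c) * prod N (λ j → block (d * j))
  blocks N = begin
    prod (N * p) term
      ≡⟨ prod-blocks N p term ⟩
    prod N (λ j → prod p (λ i → term (j * p + i)))
      ≡⟨ prod-cong N (λ j _ → prod-cong p (λ i _ → shift j i)) ⟩
    prod N (λ j → prod p (λ i → d * j * p + term i))
      ≡⟨ prod-cong N (λ j _ → segment (d * j)) ⟩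
    prod N (λ j → p * (d * j + c) * block (d * j))
      ≡⟨ prod-* N (λ j → p * (d * j + c)) (λ j → block (d * j)) ⟩
    prod N (λ j → p * (d * j + c)) * prod N (λ j → block (d * j))
      ≡⟨ cong (_* prod N (λ j → block (d * j))) (prod-* N (λ _ → p) (λ j → d * j + c)) ⟩
    prod N (λ _ → p) * prod N (λ j → d * j + c) * prod N (λ j → block (d * j))
      ≡⟨ cong (λ z → z * prod N (λ j → d * j + c) * prod N (λ j → block (d * j))) (prod-const N p) ⟩
    p ^ N * prod N (λ j → d * j + c) * prod N (λ j → block (d * j))
      ∎
    where
    shift : ∀ j i → term (j * p + i) ≡ d * j * p + term i
    shift j i = distribute d j p i r
      where
      distribute : ∀ d j p i r → d * (j * p + i) + r ≡ d * j * p + (d * i + r)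
      distribute = solve-∀

-- Blocks of  k ↦ d k + 1  for d ≥ 2 and p = d m + 1 = 2m + 2h + 1.  The factors of a
-- block fall into pairs x + y ≡ 0 (mod p): the index i < m is paired with
-- m + 1 + (m - 1 - i), and the remaining 2h indices are paired symmetrically.
-- Consequently block K ≡ block 0 (mod p²) for every K (periodicity), and block 0 is
-- congruent to the block of the reflected progression k ↦ d k + (d - 1).
module PairedBlock (d-1 m h p : ℕ) (p≡ : m + suc (m + (h + h)) ≡ p)
                   (middle : suc d-1 * m + 1 ≡ 1 * p) where

  d n : ℕ
  d = suc d-1
  n = m + (h + h)

  open Block d 1 m n 1 p p≡ middle public

  dm+1≡p : d * m + 1 ≡ p
  dm+1≡p = trans middle (*-identityˡ p)

  -- The block as two pairs of runs: run₁ is paired with run₂, run₃ with run₄.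
  run₁ run₂ run₃ run₄ : ℕ → ℕ
  run₁ K = prod m (λ i → K * p + term i)
  run₂ K = prod m (λ i → K * p + term (m + suc i))
  run₃ K = prod h (λ i → K * p + term (m + suc (m + i)))
  run₄ K = prod h (λ i → K * p + term (m + suc (m + (h + i))))

  block-runs : ∀ K → block K ≡ (run₁ K * run₂ K) * (run₃ K * run₄ K)
  block-runs K = begin
    run₁ K * prod (m + (h + h)) g                                     ≡⟨ cong (run₁ K *_) (prod-+ m (h + h) g) ⟩
    run₁ K * (run₂ K * prod (h + h) (λ i → g (m + i)))               ≡⟨ cong (λ z → run₁ K * (run₂ K * z)) (prod-+ h h (λ i → g (m + i))) ⟩
    run₁ K * (run₂ K * (run₃ K * run₄ K))                            ≡⟨ sym (*-assoc (run₁ K) (run₂ K) _) ⟩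
    (run₁ K * run₂ K) * (run₃ K * run₄ K)                            ∎
    where
    open ≡-Reasoning
    g : ℕ → ℕ
    g i = K * p + term (m + suc i)

  pair-sum₁ : ∀ i t → i + suc t ≡ m → p ∣ term i + term (m + suc t)
  pair-sum₁ i t i+1+t≡m = divides 2 (begin
    term i + term (m + suc t)        ≡⟨ expand d-1 m i t ⟩
    d * (i + suc t) + (d * m + 2)    ≡⟨ cong (λ z → d * z + (d * m + 2)) i+1+t≡m ⟩
    d * m + (d * m + 2)              ≡⟨ double d-1 m ⟩
    2 * (d * m + 1)                  ≡⟨ cong (2 *_) dm+1≡p ⟩
    2 * p                            ∎)
    where
    open ≡-Reasoning
    expand : ∀ d-1 m i t → suc d-1 * i + 1 + (suc d-1 * (m + suc t) + 1) ≡ suc d-1 * (i + suc t) + (suc d-1 * m + 2)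
    expand = solve-∀
    double : ∀ d-1 m → suc d-1 * m + (suc d-1 * m + 2) ≡ 2 * (suc d-1 * m + 1)
    double = solve-∀

  pair-sum₂ : ∀ i t → i + suc t ≡ h → p ∣ term (m + suc (m + i)) + term (m + suc (m + (h + t)))
  pair-sum₂ i t i+1+t≡h = divides (d + 2) (begin
    term (m + suc (m + i)) + term (m + suc (m + (h + t)))   ≡⟨ expand d-1 m h i t ⟩
    d * (i + suc t) + (d * (m + suc (m + (m + m + h))) + 2)  ≡⟨ cong (λ z → d * z + (d * (m + suc (m + (m + m + h))) + 2)) i+1+t≡h ⟩
    d * h + (d * (m + suc (m + (m + m + h))) + 2)           ≡⟨ regroup d-1 m h ⟩
    d * (m + suc (m + (h + h))) + 2 * (d * m + 1)           ≡⟨ cong₂ (λ a b → d * a + 2 * b) p≡ dm+1≡p ⟩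
    d * p + 2 * p                                           ≡⟨ sym (*-distribʳ-+ p d 2) ⟩
    (d + 2) * p                                             ∎)
    where
    open ≡-Reasoning
    expand : ∀ d-1 m h i t → suc d-1 * (m + suc (m + i)) + 1 + (suc d-1 * (m + suc (m + (h + t))) + 1)
                           ≡ suc d-1 * (i + suc t) + (suc d-1 * (m + suc (m + (m + m + h))) + 2)
    expand = solve-∀
    regroup : ∀ d-1 m h → suc d-1 * h + (suc d-1 * (m + suc (m + (m + m + h))) + 2)
                        ≡ suc d-1 * (m + suc (m + (h + h))) + 2 * (suc d-1 * m + 1)
    regroup = solve-∀

  periodic : ∀ K → block K ≈ block 0 [mod p * p ]
  periodic K = begin
    block K                                ≡⟨ block-runs K ⟩
    (run₁ K * run₂ K) * (run₃ K * run₄ K)  ≈⟨ ≈-*-cong (≈-prod-paired m (λ i t e → shift-pair p K (pair-sum₁ i t e)))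
                                                       (≈-prod-paired h (λ i t e → shift-pair p K (pair-sum₂ i t e))) ⟩
    (run₁ 0 * run₂ 0) * (run₃ 0 * run₄ 0)  ≡⟨ block-runs 0 ⟨
    block 0                                ∎
    where open ≈-Reasoning (p * p)

  -- The reflected progression k ↦ d k + (d - 1) meets (d - 1) p at k = n.
  n≡d-1*m : n ≡ d-1 * m
  n≡d-1*m = +-cancelˡ-≡ m n (d-1 * m) (suc-injective (begin
    suc (m + n)    ≡⟨ sym (+-suc m n) ⟩
    m + suc n      ≡⟨ p≡ ⟩
    p              ≡⟨ sym dm+1≡p ⟩
    d * m + 1      ≡⟨ +-comm (d * m) 1 ⟩
    suc (d * m)    ∎))
    where open ≡-Reasoning

  reflected-length : n + suc m ≡ p
  reflected-length = trans (+-suc n m) (trans (cong suc (+-comm n m)) (trans (sym (+-suc m n)) p≡))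

  reflected-middle : d * n + d-1 ≡ d-1 * p
  reflected-middle = begin
    d * n + d-1              ≡⟨ cong (λ z → d * z + d-1) n≡d-1*m ⟩
    d * (d-1 * m) + d-1      ≡⟨ factor d-1 m ⟩
    d-1 * (d * m + 1)        ≡⟨ cong (d-1 *_) dm+1≡p ⟩
    d-1 * p                  ∎
    where
    open ≡-Reasoning
    factor : ∀ d-1 m → suc d-1 * (d-1 * m) + d-1 ≡ d-1 * (suc d-1 * m + 1)
    factor = solve-∀

  module Reflected = Block d d-1 n m d-1 p reflected-length reflected-middle

  -- The reflected block as two pairs of runs, matched with (run₃, run₄) and (run₁, run₂).
  reflected-run₁ reflected-run₂ reflected-run₃ reflected-run₄ : ℕ
  reflected-run₁ = prod h Reflected.term
  reflected-run₂ = prod h (λ i → Reflected.term (h + i))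
  reflected-run₃ = prod m (λ i → Reflected.term (h + h + i))
  reflected-run₄ = prod m (λ i → Reflected.term (n + suc i))

  reflected-runs : Reflected.block 0 ≡ (reflected-run₁ * reflected-run₂) * (reflected-run₃ * reflected-run₄)
  reflected-runs = begin
    prod n f * reflected-run₄                                          ≡⟨ cong (λ L → prod L f * reflected-run₄) (+-comm m (h + h)) ⟩
    prod (h + h + m) f * reflected-run₄                                ≡⟨ cong (_* reflected-run₄) (prod-+ (h + h) m f) ⟩
    prod (h + h) f * reflected-run₃ * reflected-run₄                   ≡⟨ cong (λ z → z * reflected-run₃ * reflected-run₄) (prod-+ h h f) ⟩
    reflected-run₁ * reflected-run₂ * reflected-run₃ * reflected-run₄  ≡⟨ *-assoc (reflected-run₁ * reflected-run₂) reflected-run₃ reflected-run₄ ⟩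
    (reflected-run₁ * reflected-run₂) * (reflected-run₃ * reflected-run₄) ∎
    where
    open ≡-Reasoning
    f : ℕ → ℕ
    f = Reflected.term

  -- Matched factors u, v of the reflected block and x, y of the block satisfy
  -- u + y ≡ v + x ≡ d p.
  private
    reach-dp : ∀ {i t L} A → i + suc t ≡ L → d * L + A ≡ d * p → d * (i + suc t) + A ≡ d * p
    reach-dp A i+1+t≡L dL+A≡dp = trans (cong (λ z → d * z + A) i+1+t≡L) dL+A≡dp

    d*p-as-sum : ∀ {X} → X ≡ d * (m + suc (m + (h + h))) → X ≡ d * p
    d*p-as-sum eq = trans eq (cong (d *_) p≡)

  reflection : Reflected.block 0 ≈ block 0 [mod p * p ]
  reflection = begin
    Reflected.block 0                                                        ≡⟨ reflected-runs ⟩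
    (reflected-run₁ * reflected-run₂) * (reflected-run₃ * reflected-run₄)   ≈⟨ ≈-*-cong (≈-prod-paired h pairs₃₄) (≈-prod-paired m pairs₁₂) ⟩
    (run₃ 0 * run₄ 0) * (run₁ 0 * run₂ 0)                                    ≡⟨ *-comm (run₃ 0 * run₄ 0) (run₁ 0 * run₂ 0) ⟩
    (run₁ 0 * run₂ 0) * (run₃ 0 * run₄ 0)                                    ≡⟨ block-runs 0 ⟨
    block 0                                                                  ∎
    where
    open ≈-Reasoning (p * p)
    dp-multiple : p ∣ d * p
    dp-multiple = divides d refl

    pairs₃₄ : ∀ i t → i + suc t ≡ h →
              Reflected.term i * Reflected.term (h + t) ≈ term (m + suc (m + i)) * term (m + suc (m + (h + t))) [mod p * p ]
    pairs₃₄ i t e = reflect-pair p {d * p} {Reflected.term i} {Reflected.term (h + t)}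
                                 {term (m + suc (m + i))} {term (m + suc (m + (h + t)))} dp-multiple
      (trans (expand-u d-1 m h i t) (reach-dp (d * (m + suc (m + h))) e (d*p-as-sum (close d-1 m h))))
      (trans (expand-v d-1 m h i t) (reach-dp (d * (m + suc (m + h))) e (d*p-as-sum (close d-1 m h))))
      (pair-sum₂ i t e)
      where
      expand-u : ∀ d-1 m h i t → suc d-1 * i + d-1 + (suc d-1 * (m + suc (m + (h + t))) + 1)
                               ≡ suc d-1 * (i + suc t) + suc d-1 * (m + suc (m + h))
      expand-u = solve-∀
      expand-v : ∀ d-1 m h i t → suc d-1 * (h + t) + d-1 + (suc d-1 * (m + suc (m + i)) + 1)
                               ≡ suc d-1 * (i + suc t) + suc d-1 * (m + suc (m + h))
      expand-v = solve-∀
      close : ∀ d-1 m h → suc d-1 * h + suc d-1 * (m + suc (m + h)) ≡ suc d-1 * (m + suc (m + (h + h)))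
      close = solve-∀

    pairs₁₂ : ∀ i t → i + suc t ≡ m →
              Reflected.term (h + h + i) * Reflected.term (n + suc t) ≈ term i * term (m + suc t) [mod p * p ]
    pairs₁₂ i t e = reflect-pair p {d * p} {Reflected.term (h + h + i)} {Reflected.term (n + suc t)}
                                 {term i} {term (m + suc t)} dp-multiple
      (trans (expand-u d-1 m h i t) (reach-dp (d * suc n) e (d*p-as-sum (close d-1 m h))))
      (trans (expand-v d-1 m h i t) (reach-dp (d * suc n) e (d*p-as-sum (close d-1 m h))))
      (pair-sum₁ i t e)
      where
      expand-u : ∀ d-1 m h i t → suc d-1 * (h + h + i) + d-1 + (suc d-1 * (m + suc t) + 1)
                               ≡ suc d-1 * (i + suc t) + suc d-1 * suc (m + (h + h))
      expand-u = solve-∀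
      expand-v : ∀ d-1 m h i t → suc d-1 * (m + (h + h) + suc t) + d-1 + (suc d-1 * i + 1)
                               ≡ suc d-1 * (i + suc t) + suc d-1 * suc (m + (h + h))
      expand-v = solve-∀
      close : ∀ d-1 m h → suc d-1 * m + suc d-1 * suc (m + (h + h)) ≡ suc d-1 * (m + suc (m + (h + h)))
      close = solve-∀

-- Blocks of the factorial (d = 1) for odd p = 2h + 1: the block is ∏_{i < 2h} (K p + i + 1),
-- whose factors pair up as (i + 1) + (2h - i) = p.
module FactorialBlock (h p : ℕ) (p≡ : h + h + 1 ≡ p) where

  middle : 1 * (h + h) + 1 ≡ 1 * p
  middle = trans (cong (_+ 1) (*-identityˡ (h + h))) (trans p≡ (sym (*-identityˡ p)))

  open Block 1 1 (h + h) 0 1 p p≡ middle public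

  factorial : ∀ N → N ! ≡ prod N term
  factorial N = trans (n!≡prod N) (prod-cong N (λ k _ → sym (suc-as-term k)))
    where
    suc-as-term : ∀ k → 1 * k + 1 ≡ suc k
    suc-as-term = solve-∀

  factorial-segment : ∀ K → prod p (λ i → suc (K * p + i)) ≡ p * (K + 1) * block K
  factorial-segment K = trans (prod-cong p (λ i _ → as-term K p i)) (segment K)
    where
    as-term : ∀ K p i → suc (K * p + i) ≡ K * p + (1 * i + 1)
    as-term = solve-∀

  factorial-blocks : ∀ N → (N * p) ! ≡ p ^ N * N ! * prod N (λ j → block (1 * j))
  factorial-blocks N = begin
    (N * p) !                                              ≡⟨ factorial (N * p) ⟩
    prod (N * p) term                                      ≡⟨ blocks N ⟩
    p ^ N * prod N term * prod N (λ j → block (1 * j))     ≡⟨ cong (λ z → p ^ N * z * prod N (λ j → block (1 * j))) (factorial N) ⟨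
    p ^ N * N ! * prod N (λ j → block (1 * j))             ∎
    where open ≡-Reasoning

  -- Blocks of the factorial are prime to p: their factors lie strictly between multiples of p.
  block-unit : Prime p → ∀ K → p ∤ block K
  block-unit p-prime K = ∤-* (∤-prod (h + h) factor-unit) p∤1
    where
    open PrimeDivisibility p-prime
    factor-unit : ∀ i → i < h + h → p ∤ K * p + (1 * i + 1)
    factor-unit i i<2h = subst (λ z → p ∤ K * p + z) (sym (one-plus i))
                               (∤-residue K z<s (subst (suc i <_) (trans (+-comm 1 (h + h)) p≡) (s≤s i<2h)))
      where
      one-plus : ∀ i → 1 * i + 1 ≡ suc i
      one-plus = solve-∀

  block-halves : ∀ K → block K ≡ prod h (λ i → K * p + term i) * prod h (λ i → K * p + term (h + i))
  block-halves K = trans (*-identityʳ _) (prod-+ h h (λ i → K * p + term i))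

  pair-sum : ∀ i t → i + suc t ≡ h → p ∣ term i + term (h + t)
  pair-sum i t i+1+t≡h = divides 1 (begin
    term i + term (h + t)     ≡⟨ expand i h t ⟩
    (i + suc t) + h + 1       ≡⟨ cong (λ z → z + h + 1) i+1+t≡h ⟩
    h + h + 1                 ≡⟨ p≡ ⟩
    p                         ≡⟨ *-identityˡ p ⟨
    1 * p                     ∎)
    where
    open ≡-Reasoning
    expand : ∀ i h t → 1 * i + 1 + (1 * (h + t) + 1) ≡ (i + suc t) + h + 1
    expand = solve-∀

  periodic : ∀ K → block K ≈ block 0 [mod p * p ]
  periodic K = begin
    block K                                                               ≡⟨ block-halves K ⟩
    prod h (λ i → K * p + term i) * prod h (λ i → K * p + term (h + i))  ≈⟨ ≈-prod-paired h (λ i t e → shift-pair p K (pair-sum i t e)) ⟩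
    prod h term * prod h (λ i → term (h + i))                            ≡⟨ block-halves 0 ⟨
    block 0                                                               ∎
    where open ≈-Reasoning (p * p)

module BlockProducts (q : ℕ) where
  open ≡-Reasoning

  p : ℕ
  p = suc q

  Decomposes : (ℕ → ℕ) → (ℕ → ℕ) → Set
  Decomposes F B = ∀ n → F (n * p) ≡ p ^ n * F n * prod n B

  blocks-* : ∀ {F G BF BG} → Decomposes F BF → Decomposes G BG →
             ∀ n → F (n * p) * G (n * p) ≡ (p * p) ^ n * (F n * G n) * prod n (λ j → BF j * BG j)
  blocks-* {F} {G} {BF} {BG} F-blocks G-blocks n = begin
    F (n * p) * G (n * p)                                          ≡⟨ cong₂ _*_ (F-blocks n) (G-blocks n) ⟩
    p ^ n * F n * prod n BF * (p ^ n * G n * prod n BG)            ≡⟨ regroup (p ^ n) (F n) (prod n BF) (G n) (prod n BG) ⟩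
    p ^ n * p ^ n * (F n * G n) * (prod n BF * prod n BG)          ≡⟨ cong₂ (λ a b → a * (F n * G n) * b) (^-distribʳ-* n p p) (prod-* n BF BG) ⟨
    (p * p) ^ n * (F n * G n) * prod n (λ j → BF j * BG j)         ∎
    where
    regroup : ∀ a b c d e → a * b * c * (a * d * e) ≡ a * a * (b * d) * (c * e)
    regroup = solve-∀

  scaled-blocks-* : ∀ c {F G BF BG} → Decomposes F BF → Decomposes G BG → ∀ n →
                    c ^ (n * p) * (F (n * p) * G (n * p))
                      ≡ (p * p) ^ n * (c ^ n * (F n * G n)) * prod n (λ j → c ^ q * (BF j * BG j))
  scaled-blocks-* c {F} {G} {BF} {BG} F-blocks G-blocks n = begin
    c ^ (n * p) * (F (n * p) * G (n * p))
      ≡⟨ cong₂ _*_ c^np (blocks-* F-blocks G-blocks n) ⟩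
    c ^ n * (c ^ q) ^ n * ((p * p) ^ n * (F n * G n) * prod n (λ j → BF j * BG j))
      ≡⟨ regroup (c ^ n) ((c ^ q) ^ n) ((p * p) ^ n) (F n * G n) (prod n (λ j → BF j * BG j)) ⟩
    (p * p) ^ n * (c ^ n * (F n * G n)) * ((c ^ q) ^ n * prod n (λ j → BF j * BG j))
      ≡⟨ cong (λ z → (p * p) ^ n * (c ^ n * (F n * G n)) * (z * prod n (λ j → BF j * BG j))) (prod-const n (c ^ q)) ⟨
    (p * p) ^ n * (c ^ n * (F n * G n)) * (prod n (λ _ → c ^ q) * prod n (λ j → BF j * BG j))
      ≡⟨ cong ((p * p) ^ n * (c ^ n * (F n * G n)) *_) (prod-* n (λ _ → c ^ q) (λ j → BF j * BG j)) ⟨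
    (p * p) ^ n * (c ^ n * (F n * G n)) * prod n (λ j → c ^ q * (BF j * BG j))
      ∎
    where
    c^np : c ^ (n * p) ≡ c ^ n * (c ^ q) ^ n
    c^np = begin
      c ^ (n * suc q)        ≡⟨ cong (c ^_) (*-suc n q) ⟩
      c ^ (n + n * q)        ≡⟨ ^-distribˡ-+-* c n (n * q) ⟩
      c ^ n * c ^ (n * q)    ≡⟨ cong (λ e → c ^ n * c ^ e) (*-comm n q) ⟩
      c ^ n * c ^ (q * n)    ≡⟨ cong (c ^ n *_) (^-*-assoc c q n) ⟨
      c ^ n * (c ^ q) ^ n    ∎
    regroup : ∀ a b c d e → a * b * (c * d * e) ≡ c * (a * d) * (b * e)
    regroup = solve-∀

-- Rationals as fractions.  x ≐ a ∕1+ b  says that x equals a / (1 + b); this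
-- unnormalised form is preserved by the field operations.
infix 4 _≐_∕1+_
_≐_∕1+_ : ℚ → ℤ → ℕ → Set
x ≐ a ∕1+ b = ℚ.toℚᵘ x ≃ᵘ mkℚᵘ a b

module _ {x y : ℚ} {a c : ℤ} {b e : ℕ} where

  ≐-* : x ≐ a ∕1+ b → y ≐ c ∕1+ e → x ℚ.* y ≐ a ℤ.* c ∕1+ (e + b * suc e)
  ≐-* x≐ y≐ = ℚᵘ.≃-trans (ℚ.toℚᵘ-homo-* x y) (ℚᵘ.*-cong x≐ y≐)

  ≐-+ : x ≐ a ∕1+ b → y ≐ c ∕1+ e → x ℚ.+ y ≐ a ℤ.* ℤ.+ suc e ℤ.+ c ℤ.* ℤ.+ suc b ∕1+ (e + b * suc e)
  ≐-+ x≐ y≐ = ℚᵘ.≃-trans (ℚ.toℚᵘ-homo-+ x y) (ℚᵘ.+-cong x≐ y≐)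

≐-cross : ∀ {x a c b e} → x ≐ a ∕1+ b → a ℤ.* ℤ.+ suc e ≡ c ℤ.* ℤ.+ suc b → x ≐ c ∕1+ e
≐-cross x≐ ae≡cb = ℚᵘ.≃-trans x≐ (*≡* ae≡cb)

≐-neg : ∀ {x a b} → x ≐ a ∕1+ b → ℚ.- x ≐ ℤ.- a ∕1+ b
≐-neg {x} x≐ = ℚᵘ.≃-trans (ℚ.toℚᵘ-homo‿- x) (ℚᵘ.-‿cong x≐)

≐-abs : ∀ {x a b} → x ≐ a ∕1+ b → ℤ.∣ ↥ x ∣ * suc b ≡ ℤ.∣ a ∣ * ↧ₙ x
≐-abs {x@(mkℚ _ _ _)} {a} {b} (*≡* eq) = begin
  ℤ.∣ ↥ x ∣ * suc b            ≡⟨ ℤ.abs-* (↥ x) (ℤ.+ suc b) ⟨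
  ℤ.∣ ↥ x ℤ.* ℤ.+ suc b ∣      ≡⟨ cong ℤ.∣_∣ eq ⟩
  ℤ.∣ a ℤ.* ↧ x ∣              ≡⟨ ℤ.abs-* a (↧ x) ⟩
  ℤ.∣ a ∣ * ↧ₙ x               ∎
  where open ≡-Reasoning

≐-den∣ : ∀ {x a b} → x ≐ a ∕1+ b → ↧ₙ x ∣ suc b
≐-den∣ {x@(mkℚ _ _ coprime)} {a} {b} x≐ =
  coprime-divisor (Coprime.sym (Coprime.recompute coprime))
                  (subst (↧ₙ x ∣_) (sym (≐-abs {x} {a} {b} x≐)) (n∣m*n ℤ.∣ a ∣))

≐-cong : ∀ {x a c b e} → x ≐ a ∕1+ b → a ≡ c → suc b ≡ suc e → x ≐ c ∕1+ e
≐-cong {a = a} x≐ refl 1+b≡1+e = ≐-cross x≐ (cong (λ z → a ℤ.* ℤ.+ z) (sym 1+b≡1+e))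

infix 4 _≐_÷_
_≐_÷_ : ℚ → ℕ → ℕ → Set
x ≐ A ÷ B = x ≐ ℤ.+ A ∕1+ pred B

≐-/ : ∀ A B .{{_ : NonZero B}} → (ℤ.+ A ℚ./ B) ≐ A ÷ B
≐-/ A (suc B-1) = ℚ.toℚᵘ-fromℚᵘ (mkℚᵘ (ℤ.+ A) B-1)

module _ {A B : ℕ} .{{_ : NonZero B}} where

  ≐-reduce : ∀ {x C E} .{{_ : NonZero E}} → x ≐ A ÷ B → A * E ≡ C * B → x ≐ C ÷ E
  ≐-reduce {x} {C} {E} x≐ AE≡CB = ≐-cross x≐ (begin
    ℤ.+ A ℤ.* ℤ.+ suc (pred E)     ≡⟨ cong (λ z → ℤ.+ A ℤ.* ℤ.+ z) (suc-pred E) ⟩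
    ℤ.+ A ℤ.* ℤ.+ E                ≡⟨ ℤ.pos-* A E ⟨
    ℤ.+ (A * E)                    ≡⟨ cong ℤ.+_ AE≡CB ⟩
    ℤ.+ (C * B)                    ≡⟨ ℤ.pos-* C B ⟩
    ℤ.+ C ℤ.* ℤ.+ B                ≡⟨ cong (λ z → ℤ.+ C ℤ.* ℤ.+ z) (suc-pred B) ⟨
    ℤ.+ C ℤ.* ℤ.+ suc (pred B)     ∎)
    where open ≡-Reasoning

  module _ {x y : ℚ} {C E : ℕ} .{{_ : NonZero E}} where

    private
      1+denominator : suc (pred E + pred B * suc (pred E)) ≡ suc (pred (B * E))
      1+denominator = begin
        suc (pred B) * suc (pred E)    ≡⟨ cong₂ _*_ (suc-pred B) (suc-pred E) ⟩
        B * E                          ≡⟨ suc-pred (B * E) {{m*n≢0 B E}} ⟨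
        suc (pred (B * E))             ∎
        where open ≡-Reasoning

    ≐-*÷ : x ≐ A ÷ B → y ≐ C ÷ E → x ℚ.* y ≐ A * C ÷ (B * E)
    ≐-*÷ x≐ y≐ = ≐-cong (≐-* x≐ y≐) (sym (ℤ.pos-* A C)) 1+denominator

    ≐-+÷ : x ≐ A ÷ B → y ≐ C ÷ E → x ℚ.+ y ≐ A * E + C * B ÷ (B * E)
    ≐-+÷ x≐ y≐ = ≐-cong (≐-+ x≐ y≐) numerator 1+denominator
      where
      open ≡-Reasoning
      numerator : ℤ.+ A ℤ.* ℤ.+ suc (pred E) ℤ.+ ℤ.+ C ℤ.* ℤ.+ suc (pred B) ≡ ℤ.+ (A * E + C * B)
      numerator = begin
        ℤ.+ A ℤ.* ℤ.+ suc (pred E) ℤ.+ ℤ.+ C ℤ.* ℤ.+ suc (pred B)  ≡⟨ cong₂ (λ u v → ℤ.+ A ℤ.* ℤ.+ u ℤ.+ ℤ.+ C ℤ.* ℤ.+ v) (suc-pred E) (suc-pred B) ⟩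
        ℤ.+ A ℤ.* ℤ.+ E ℤ.+ ℤ.+ C ℤ.* ℤ.+ B                          ≡⟨ cong₂ ℤ._+_ (ℤ.pos-* A E) (ℤ.pos-* C B) ⟨
        ℤ.+ (A * E) ℤ.+ ℤ.+ (C * B)                                  ≡⟨ ℤ.pos-+ (A * E) (C * B) ⟨
        ℤ.+ (A * E + C * B)                                          ∎

≐-poch : ∀ d-1 m → poch (ℤ.+ 1 ℚ./ suc d-1) m ≐ prod m (λ k → suc d-1 * k + 1) ÷ (suc d-1 ^ m)
≐-poch d-1 zero    = ℚᵘ.≃-refl
≐-poch d-1 (suc m) =
  ≐-reduce {{m*n≢0 (d ^ m) (d * 1) {{d^m≢0}}}} {{m^n≢0 d (suc m)}}
    (≐-*÷ {{d^m≢0}} (≐-poch d-1 m) (≐-+÷ (≐-/ 1 d) (≐-/ m 1)))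
    (rearrange (prod m (λ k → d * k + 1)) d-1 m (d ^ m))
  where
  d : ℕ
  d = suc d-1
  d^m≢0 : NonZero (d ^ m)
  d^m≢0 = m^n≢0 d m
  rearrange : ∀ F d-1 m P → F * (1 * 1 + m * suc d-1) * (suc d-1 * P) ≡ F * (suc d-1 * m + 1) * (P * (suc d-1 * 1))
  rearrange = solve-∀

≐-sequence : ∀ c d₁-1 d₂-1 m →
  ℕ→ℚ ((c * suc d₁-1 * suc d₂-1) ^ m) ℚ.* (poch (ℤ.+ 1 ℚ./ suc d₁-1) m ℚ.* poch (ℤ.+ 1 ℚ./ suc d₂-1) m) ℚ.* inv1sq m
    ≐ c ^ m * (prod m (λ k → suc d₁-1 * k + 1) * prod m (λ k → suc d₂-1 * k + 1)) ÷ (m ! * m !)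
≐-sequence c d₁-1 d₂-1 m =
  ≐-reduce {{denominator≢0}} {{m !* m !≢0}}
    (≐-*÷ {{1*P≢0}} {{m !* m !≢0}}
      (≐-*÷ {B = 1} {{_}} {{P≢0}} (≐-/ ((c * d₁ * d₂) ^ m) 1)
                          (≐-*÷ {{m^n≢0 d₁ m}} {{m^n≢0 d₂ m}} (≐-poch d₁-1 m) (≐-poch d₂-1 m)))
      (≐-/ 1 (m ! * m !) {{m !* m !≢0}}))
    (begin
      (c * d₁ * d₂) ^ m * (F₁ * F₂) * 1 * (m ! * m !)             ≡⟨ cong (λ z → z * (F₁ * F₂) * 1 * (m ! * m !)) cd₁d₂^m ⟩
      c ^ m * d₁ ^ m * d₂ ^ m * (F₁ * F₂) * 1 * (m ! * m !)        ≡⟨ regroup (c ^ m) (d₁ ^ m) (d₂ ^ m) (F₁ * F₂) (m ! * m !) ⟩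
      c ^ m * (F₁ * F₂) * (1 * (d₁ ^ m * d₂ ^ m) * (m ! * m !))    ∎)
  where
  open ≡-Reasoning
  d₁ d₂ F₁ F₂ : ℕ
  d₁ = suc d₁-1
  d₂ = suc d₂-1
  F₁ = prod m (λ k → d₁ * k + 1)
  F₂ = prod m (λ k → d₂ * k + 1)
  P≢0 : NonZero (d₁ ^ m * d₂ ^ m)
  P≢0 = m*n≢0 (d₁ ^ m) (d₂ ^ m) {{m^n≢0 d₁ m}} {{m^n≢0 d₂ m}}
  1*P≢0 : NonZero (1 * (d₁ ^ m * d₂ ^ m))
  1*P≢0 = m*n≢0 1 (d₁ ^ m * d₂ ^ m) {{_}} {{P≢0}}
  denominator≢0 : NonZero (1 * (d₁ ^ m * d₂ ^ m) * (m ! * m !))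
  denominator≢0 = m*n≢0 (1 * (d₁ ^ m * d₂ ^ m)) (m ! * m !) {{1*P≢0}} {{m !* m !≢0}}
  cd₁d₂^m : (c * d₁ * d₂) ^ m ≡ c ^ m * d₁ ^ m * d₂ ^ m
  cd₁d₂^m = trans (^-distribʳ-* m (c * d₁) d₂) (cong (_* d₂ ^ m) (^-distribʳ-* m c d₁))
  regroup : ∀ x y z f d → x * y * z * f * 1 * d ≡ x * f * (1 * (y * z) * d)
  regroup = solve-∀

module _ {p : ℕ} (p-prime : Prime p) where
  open PrimeDivisibility p-prime

  ≐-coprime-den : ∀ {x a b} → x ≐ a ∕1+ b → p ∤ suc b → Coprime (↧ₙ x) p
  ≐-coprime-den {x} {a} {b} x≐ p∤1+b (c∣den , c∣p) = ∤⇒coprime p∤1+b (∣-trans c∣den (≐-den∣ {x} {a} {b} x≐) , c∣p)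

  fraction-congruence : ∀ {x y A B C E} .{{_ : NonZero B}} .{{_ : NonZero E}} →
                        x ≐ A ÷ B → y ≐ C ÷ E → p ∤ B → p ∤ E →
                        A * E ≈ C * B [mod p * p ] → x ≡ y [modpow p , 2 ]
  fraction-congruence {x} {y} {A} {B} {C} {E} x≐ y≐ p∤B p∤E AE≈CB =
    ≐-coprime-den x≐ p∤1+b , ≐-coprime-den y≐ p∤1+e , p²∣numerator
    where
    open ≡-Reasoning
    b e : ℕ
    b = pred B
    e = pred E
    p∤1+b : p ∤ suc b
    p∤1+b = subst (p ∤_) (sym (suc-pred B)) p∤B
    p∤1+e : p ∤ suc e
    p∤1+e = subst (p ∤_) (sym (suc-pred E)) p∤E

    difference : ℤ
    difference = ℤ.+ A ℤ.* ℤ.+ suc e ℤ.+ ℤ.- ℤ.+ C ℤ.* ℤ.+ suc b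

    x-y≐ : x ℚ.- y ≐ difference ∕1+ (e + b * suc e)
    x-y≐ = ≐-+ x≐ (≐-neg y≐)

    |difference| : ℤ.∣ difference ∣ ≡ ℤ.∣ (A * E) ⊖ (C * B) ∣
    |difference| = cong ℤ.∣_∣ (begin
      difference                                              ≡⟨ subtract (ℤ.+ A) (ℤ.+ suc e) (ℤ.+ C) (ℤ.+ suc b) ⟩
      ℤ.+ A ℤ.* ℤ.+ suc e ℤ.- ℤ.+ C ℤ.* ℤ.+ suc b              ≡⟨ cong₂ (λ u v → ℤ.+ A ℤ.* ℤ.+ u ℤ.- ℤ.+ C ℤ.* ℤ.+ v) (suc-pred E) (suc-pred B) ⟩
      ℤ.+ A ℤ.* ℤ.+ E ℤ.- ℤ.+ C ℤ.* ℤ.+ B                      ≡⟨ cong₂ ℤ._-_ (ℤ.pos-* A E) (ℤ.pos-* C B) ⟨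
      ℤ.+ (A * E) ℤ.- ℤ.+ (C * B)                              ≡⟨ ℤ.[+m]-[+n]≡m⊖n (A * E) (C * B) ⟩
      (A * E) ⊖ (C * B)                                        ∎)
      where
      subtract : ∀ a e′ c b′ → a ℤ.* e′ ℤ.+ ℤ.- c ℤ.* b′ ≡ a ℤ.* e′ ℤ.- c ℤ.* b′
      subtract = ℤ-Solver.solve-∀

    p²∣ : p * p ∣ ℤ.∣ ↥ (x ℚ.- y) ∣
    p²∣ = p²-cancel (∤-* p∤1+b p∤1+e)
            (subst (p * p ∣_) (sym (≐-abs x-y≐))
              (∣-trans (subst (p * p ∣_) (sym |difference|) (≈⇒∣⊖∣ AE≈CB)) (m∣m*n (↧ₙ (x ℚ.- y)))))

    p²∣numerator : p ^ 2 ∣ ℤ.∣ ↥ (x ℚ.- y) ∣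
    p²∣numerator = subst (_∣ ℤ.∣ ↥ (x ℚ.- y) ∣) (cong (p *_) (sym (*-identityʳ p))) p²∣

-- Since D m may be divisible by p, one first shows that every u m is a fraction
-- with denominator prime to p (induction along m = q p + r); then
-- u (n p) = u n · ∏ x / ∏ y.
module DworkCongruence
  {p : ℕ} (p-prime : Prime p) (N D x y : ℕ → ℕ)
  (D-zero   : D 0 ≡ 1)
  (N-step   : ∀ m → N m ∣ N (suc m))
  (D-step   : ∀ m → D (suc m) ≡ D m * (suc m * suc m))
  (N-blocks : ∀ n → N (n * p) ≡ (p * p) ^ n * N n * prod n x)
  (D-blocks : ∀ n → D (n * p) ≡ (p * p) ^ n * D n * prod n y)
  (y-unit   : ∀ j → p ∤ y j)
  (x≈y      : ∀ j → x j ≈ y j [mod p * p ])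
  where
  open PrimeDivisibility p-prime
  open ≡-Reasoning

  D-nonZero : ∀ m → NonZero (D m)
  D-nonZero zero    = subst NonZero (sym D-zero) _
  D-nonZero (suc m) = subst NonZero (sym (D-step m)) (m*n≢0 (D m) (suc m * suc m) {{D-nonZero m}})

  -- N m / D m = α / β for some β prime to p.
  Integral : ℕ → Set
  Integral m = ∃[ α ] ∃[ β ] p ∤ β × β * N m ≡ α * D m

  integral-step : ∀ m → p ∤ suc m → Integral m → Integral (suc m)
  integral-step m p∤1+m (α , β , p∤β , βN≡αD) with N-step m
  ... | divides c N′≡cN = α * c , β * (suc m * suc m) , ∤-* p∤β (∤-* p∤1+m p∤1+m) , (begin
    β * (suc m * suc m) * N (suc m)     ≡⟨ cong (β * (suc m * suc m) *_) N′≡cN ⟩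
    β * (suc m * suc m) * (c * N m)     ≡⟨ regroup β (suc m * suc m) c (N m) ⟩
    β * N m * (c * (suc m * suc m))     ≡⟨ cong (_* (c * (suc m * suc m))) βN≡αD ⟩
    α * D m * (c * (suc m * suc m))     ≡⟨ regroup′ α (D m) c (suc m * suc m) ⟩
    α * c * (D m * (suc m * suc m))     ≡⟨ cong (α * c *_) (D-step m) ⟨
    α * c * D (suc m)                   ∎)
    where
    regroup : ∀ a b c d → a * b * (c * d) ≡ a * d * (c * b)
    regroup = solve-∀
    regroup′ : ∀ a b c d → a * b * (c * d) ≡ a * c * (b * d)
    regroup′ = solve-∀

  scale-by-blocks : ∀ n {α β} → β * N n ≡ α * D n →
                    β * prod n y * N (n * p) ≡ α * prod n x * D (n * p)
  scale-by-blocks n {α} {β} βN≡αD = begin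
    β * Y * N (n * p)            ≡⟨ cong (β * Y *_) (N-blocks n) ⟩
    β * Y * (P * N n * X)        ≡⟨ regroup β Y P (N n) X ⟩
    β * N n * (P * X * Y)        ≡⟨ cong (_* (P * X * Y)) βN≡αD ⟩
    α * D n * (P * X * Y)        ≡⟨ regroup′ α (D n) P X Y ⟩
    α * X * (P * D n * Y)        ≡⟨ cong (α * X *_) (D-blocks n) ⟨
    α * X * D (n * p)            ∎
    where
    X Y P : ℕ
    X = prod n x
    Y = prod n y
    P = (p * p) ^ n
    regroup : ∀ a b c d e → a * b * (c * d * e) ≡ a * d * (c * e * b)
    regroup = solve-∀
    regroup′ : ∀ a b c d e → a * b * (c * d * e) ≡ a * d * (c * b * e)
    regroup′ = solve-∀

  integral-blocks : ∀ n → Integral n → Integral (n * p)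
  integral-blocks n (α , β , p∤β , βN≡αD) =
    α * prod n x , β * prod n y , ∤-* p∤β (∤-prod n (λ j _ → y-unit j)) , scale-by-blocks n {α} {β} βN≡αD

  integral-tail : ∀ q r → r < p → Integral (q * p) → Integral (q * p + r)
  integral-tail q zero    _   int = subst Integral (sym (+-identityʳ (q * p))) int
  integral-tail q (suc r) r<p int = subst Integral (sym (+-suc (q * p) r))
    (integral-step (q * p + r) p∤1+qp+r (integral-tail q r (<-trans (n<1+n r) r<p) int))
    where
    p∤1+qp+r : p ∤ suc (q * p + r)
    p∤1+qp+r = subst (p ∤_) (+-suc (q * p) r) (∤-residue q z<s r<p)

  integral : ∀ m → Integral m
  integral = <-rec Integral step
    where
    step : ∀ m → (∀ {k} → k < m → Integral k) → Integral m
    step zero    _   = N 0 , 1 , p∤1 , trans (*-identityˡ (N 0)) (sym (trans (cong (N 0 *_) D-zero) (*-identityʳ (N 0))))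
    step (suc m) rec = subst Integral (sym m≡qp+r)
      (integral-tail q r (m%n<n (suc m) p) (integral-blocks q (rec (m/n<m (suc m) p 1<p))))
      where
      q r : ℕ
      q = suc m / p
      r = suc m % p
      m≡qp+r : suc m ≡ q * p + r
      m≡qp+r = trans (m≡m%n+[m/n]*n (suc m) p) (+-comm r (q * p))

  dwork : (u : ℕ → ℚ) → (∀ m → u m ≐ N m ÷ D m) → ∀ n → u (n * p) ≡ u n [modpow p , 2 ]
  dwork u u≐ n with integral n
  ... | α , β , p∤β , βN≡αD =
    fraction-congruence p-prime {{∤⇒nonZero p∤βY}} {{∤⇒nonZero p∤β}} u[np]≐ u[n]≐ p∤βY p∤β αXβ≈αβY
    where
    X Y : ℕ
    X = prod n x
    Y = prod n y
    p∤βY : p ∤ β * Y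
    p∤βY = ∤-* p∤β (∤-prod n (λ j _ → y-unit j))
    u[n]≐ : u n ≐ α ÷ β
    u[n]≐ = ≐-reduce {{D-nonZero n}} {{∤⇒nonZero p∤β}} (u≐ n) (trans (*-comm (N n) β) βN≡αD)
    u[np]≐ : u (n * p) ≐ α * X ÷ (β * Y)
    u[np]≐ = ≐-reduce {{D-nonZero (n * p)}} {{∤⇒nonZero p∤βY}} (u≐ (n * p))
                      (trans (*-comm (N (n * p)) (β * Y)) (scale-by-blocks n {α} {β} βN≡αD))
    αXβ≈αβY : α * X * β ≈ α * (β * Y) [mod p * p ]
    αXβ≈αβY = ≈-trans (≈-reflexive (swap α X β)) (≈-*ˡ α (≈-*ˡ β (≈-prod n (λ j _ → x≈y j))))
      where
      swap : ∀ a b c → a * b * c ≡ a * (c * b)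
      swap = solve-∀

-- Part (a): p = 4a + 1.  Blocks of ∏ (4k + 1) (with m = h = a) and of the factorial.
module PartA (a : ℕ) where

  p : ℕ
  p = suc (4 * a)

  private
    p≡2a+2a+1 : a + suc (a + (a + a)) ≡ p
    p≡2a+2a+1 = identity a
      where
      identity : ∀ a → a + suc (a + (a + a)) ≡ suc (4 * a)
      identity = solve-∀
    p≡4a+1 : 4 * a + 1 ≡ 1 * p
    p≡4a+1 = identity a
      where
      identity : ∀ a → 4 * a + 1 ≡ 1 * suc (4 * a)
      identity = solve-∀
    p≡a+a+a+a+1 : a + a + (a + a) + 1 ≡ p
    p≡a+a+a+a+1 = identity a
      where
      identity : ∀ a → a + a + (a + a) + 1 ≡ suc (4 * a)
      identity = solve-∀

  module B = PairedBlock 3 a a p p≡2a+2a+1 p≡4a+1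
  module R = B.Reflected
  module C = FactorialBlock (a + a) p p≡a+a+a+a+1
  open BlockProducts (4 * a) using (blocks-*; scaled-blocks-*)

  -- Computing (4p)! in two ways:  4^(p-1) · B₀ · R₀ = C₂ · C₃.
  gauss : 4 ^ (4 * a) * (B.block 0 * R.block 0) ≡ C.block 2 * C.block 3
  gauss = *-cancelʳ-≡ _ _ (p * p * 12 * Q) {{p*p*12*Q≢0}} (begin
    4 ^ (4 * a) * (B.block 0 * R.block 0) * (p * p * 12 * Q)
      ≡⟨ regroup (4 ^ (4 * a)) (B.block 0) (R.block 0) p Q ⟩
    p * 1 * B.block 0 * (p * 3 * R.block 0) * (4 ^ p * Q)
      ≡⟨ cong₂ (λ u v → u * v * (4 ^ p * Q)) (B.segment 0) (R.segment 0) ⟨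
    prod p B.term * prod p R.term * (4 ^ p * Q)
      ≡⟨ cong₂ (λ u v → u * (v * Q)) (sym odd-numbers) 4^p≡2^2p ⟩
    prod (p * 2) (λ k → 2 * k + 1) * (2 ^ (p * 2) * Q)
      ≡⟨ double-factorial (p * 2) ⟨
    prod (p * 2 * 2) suc
      ≡⟨ by-halves ⟩
    Q * (prod p (λ i → suc (2 * p + i)) * prod p (λ i → suc (3 * p + i)))
      ≡⟨ cong₂ (λ u v → Q * (u * v)) (C.factorial-segment 2) (C.factorial-segment 3) ⟩
    Q * (p * 3 * C.block 2 * (p * 4 * C.block 3))
      ≡⟨ regroup′ Q (C.block 2) (C.block 3) p ⟩
    C.block 2 * C.block 3 * (p * p * 12 * Q)
      ∎)
    where
    open ≡-Reasoning
    Q : ℕ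
    Q = prod (p * 2) suc
    p*p*12*Q≢0 : NonZero (p * p * 12 * Q)
    p*p*12*Q≢0 = m*n≢0 (p * p * 12) Q {{_}} {{subst NonZero (n!≡prod (p * 2)) ((p * 2) !≢0)}}
    4^p≡2^2p : 4 ^ p ≡ 2 ^ (p * 2)
    4^p≡2^2p = trans (^-*-assoc 2 2 p) (cong (2 ^_) (*-comm 2 p))
    -- the odd numbers below 4p are the numbers 4k + 1 and 4k + 3, k < p
    odd-numbers : prod (p * 2) (λ k → 2 * k + 1) ≡ prod p B.term * prod p R.term
    odd-numbers = begin
      prod (p * 2) (λ k → 2 * k + 1)                                  ≡⟨ prod-blocks p 2 (λ k → 2 * k + 1) ⟩
      prod p (λ k → 1 * (2 * (k * 2 + 0) + 1) * (2 * (k * 2 + 1) + 1)) ≡⟨ prod-cong p (λ k _ → mod-4 k) ⟩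
      prod p (λ k → B.term k * R.term k)                              ≡⟨ prod-* p B.term R.term ⟩
      prod p B.term * prod p R.term                                   ∎
      where
      mod-4 : ∀ k → 1 * (2 * (k * 2 + 0) + 1) * (2 * (k * 2 + 1) + 1) ≡ (4 * k + 1) * (4 * k + 3)
      mod-4 = solve-∀
    by-halves : prod (p * 2 * 2) suc ≡ Q * (prod p (λ i → suc (2 * p + i)) * prod p (λ i → suc (3 * p + i)))
    by-halves = begin
      prod (p * 2 * 2) suc                                                  ≡⟨ cong (λ L → prod L suc) (split p) ⟩
      prod (p * 2 + (p + p)) suc                                            ≡⟨ prod-+ (p * 2) (p + p) suc ⟩
      Q * prod (p + p) (λ i → suc (p * 2 + i))                              ≡⟨ cong (Q *_) (prod-+ p p (λ i → suc (p * 2 + i))) ⟩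
      Q * (prod p (λ i → suc (p * 2 + i)) * prod p (λ i → suc (p * 2 + (p + i))))
        ≡⟨ cong₂ (λ u v → Q * (u * v)) (prod-cong p (λ i _ → offset₂ p i)) (prod-cong p (λ i _ → offset₃ p i)) ⟩
      Q * (prod p (λ i → suc (2 * p + i)) * prod p (λ i → suc (3 * p + i))) ∎
      where
      split : ∀ p → p * 2 * 2 ≡ p * 2 + (p + p)
      split = solve-∀
      offset₂ : ∀ p i → suc (p * 2 + i) ≡ suc (2 * p + i)
      offset₂ = solve-∀
      offset₃ : ∀ p i → suc (p * 2 + (p + i)) ≡ suc (3 * p + i)
      offset₃ = solve-∀
    regroup : ∀ c b r p q → c * (b * r) * (p * p * 12 * q) ≡ p * 1 * b * (p * 3 * r) * (4 * c * q)
    regroup = solve-∀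
    regroup′ : ∀ q c₂ c₃ p → q * (p * 3 * c₂ * (p * 4 * c₃)) ≡ c₂ * c₃ * (p * p * 12 * q)
    regroup′ = solve-∀

  -- 4^(p-1) B₀² ≡ C₀² (mod p²): replace one B₀ by the reflected block, then use gauss.
  key : 4 ^ (4 * a) * (B.block 0 * B.block 0) ≈ C.block 0 * C.block 0 [mod p * p ]
  key = begin
    4 ^ (4 * a) * (B.block 0 * B.block 0)   ≈⟨ ≈-*ˡ (4 ^ (4 * a)) (≈-*ˡ (B.block 0) (≈-sym B.reflection)) ⟩
    4 ^ (4 * a) * (B.block 0 * R.block 0)   ≡⟨ gauss ⟩
    C.block 2 * C.block 3                   ≈⟨ ≈-*-cong (C.periodic 2) (C.periodic 3) ⟩
    C.block 0 * C.block 0                   ∎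
    where open ≈-Reasoning (p * p)

  F N D x y : ℕ → ℕ
  F m = prod m B.term
  N m = 4 ^ m * (F m * F m)
  D m = m ! * m !
  x j = 4 ^ (4 * a) * (B.block (4 * j) * B.block (4 * j))
  y j = C.block (1 * j) * C.block (1 * j)

  x≈y : ∀ j → x j ≈ y j [mod p * p ]
  x≈y j = begin
    4 ^ (4 * a) * (B.block (4 * j) * B.block (4 * j))  ≈⟨ ≈-*ˡ (4 ^ (4 * a)) (≈-*-cong (B.periodic (4 * j)) (B.periodic (4 * j))) ⟩
    4 ^ (4 * a) * (B.block 0 * B.block 0)              ≈⟨ key ⟩
    C.block 0 * C.block 0                              ≈⟨ ≈-*-cong (C.periodic (1 * j)) (C.periodic (1 * j)) ⟨
    C.block (1 * j) * C.block (1 * j)                  ∎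
    where open ≈-Reasoning (p * p)

  N-step : ∀ m → N m ∣ N (suc m)
  N-step m = divides (4 * (B.term m * B.term m)) (regroup (4 ^ m) (F m) (B.term m))
    where
    regroup : ∀ c f t → 4 * c * (f * t * (f * t)) ≡ 4 * (t * t) * (c * (f * f))
    regroup = solve-∀

  D-step : ∀ m → D (suc m) ≡ D m * (suc m * suc m)
  D-step m = regroup (suc m) (m !)
    where
    regroup : ∀ k f → k * f * (k * f) ≡ f * f * (k * k)
    regroup = solve-∀

  s≐ : ∀ m → s m ≐ N m ÷ D m
  s≐ = ≐-sequence 4 3 3

  theorem-a : Prime p → ∀ n → s (n * p) ≡ s n [modpow p , 2 ]
  theorem-a p-prime = dwork s s≐
    where
    open DworkCongruence p-prime N D x y refl N-step D-step
           (scaled-blocks-* 4 B.blocks B.blocks) (blocks-* C.factorial-blocks C.factorial-blocks)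
           (λ j → PrimeDivisibility.∤-* p-prime (C.block-unit p-prime (1 * j)) (C.block-unit p-prime (1 * j)))
           x≈y

-- Part (b): p = 6b + 1.  Blocks of ∏ (6k + 1) (m = b, h = 2b), of ∏ (3k + 1)
-- (m = 2b, h = b), and of the factorial.
module PartB (b : ℕ) where

  p : ℕ
  p = suc (6 * b)

  private
    p≡[6] : b + suc (b + ((b + b) + (b + b))) ≡ p
    p≡[6] = identity b
      where
      identity : ∀ b → b + suc (b + ((b + b) + (b + b))) ≡ suc (6 * b)
      identity = solve-∀
    p≡6b+1 : 6 * b + 1 ≡ 1 * p
    p≡6b+1 = identity b
      where
      identity : ∀ b → 6 * b + 1 ≡ 1 * suc (6 * b)
      identity = solve-∀
    p≡[3] : b + b + suc (b + b + (b + b)) ≡ p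
    p≡[3] = identity b
      where
      identity : ∀ b → b + b + suc (b + b + (b + b)) ≡ suc (6 * b)
      identity = solve-∀
    p≡3[2b]+1 : 3 * (b + b) + 1 ≡ 1 * p
    p≡3[2b]+1 = identity b
      where
      identity : ∀ b → 3 * (b + b) + 1 ≡ 1 * suc (6 * b)
      identity = solve-∀
    p≡3b+3b+1 : b + b + b + (b + b + b) + 1 ≡ p
    p≡3b+3b+1 = identity b
      where
      identity : ∀ b → b + b + b + (b + b + b) + 1 ≡ suc (6 * b)
      identity = solve-∀

  module B₆ = PairedBlock 5 b (b + b) p p≡[6] p≡6b+1
  module B₃ = PairedBlock 2 (b + b) b p p≡[3] p≡3[2b]+1
  module R₃ = B₃.Reflected
  module C = FactorialBlock (b + b + b) p p≡3b+3b+1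
  open BlockProducts (6 * b) using (blocks-*; scaled-blocks-*)

  -- Computing ∏_{k < 2p} (3k + 1) in two ways:  2^(p-1) · B₆ · R₃ = B₃(0) · B₃(3).
  gauss₁ : 2 ^ (6 * b) * (B₆.block 0 * R₃.block 0) ≡ B₃.block 0 * B₃.block 3
  gauss₁ = *-cancelʳ-≡ _ _ (p * p * 4) {{m*n≢0 (p * p) 4 {{m*n≢0 p p}}}} (begin
    2 ^ (6 * b) * (B₆.block 0 * R₃.block 0) * (p * p * 4)
      ≡⟨ regroup (2 ^ (6 * b)) (B₆.block 0) (R₃.block 0) p ⟩
    p * 1 * B₆.block 0 * (2 ^ p * (p * 2 * R₃.block 0))
      ≡⟨ cong₂ (λ u v → u * (2 ^ p * v)) (B₆.segment 0) (R₃.segment 0) ⟨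
    prod p B₆.term * (2 ^ p * prod p R₃.term)
      ≡⟨ by-parity ⟨
    prod (p * 2) B₃.term
      ≡⟨ by-halves ⟩
    prod p B₃.term * prod p (λ i → 3 * p + B₃.term i)
      ≡⟨ cong₂ _*_ (B₃.segment 0) (B₃.segment 3) ⟩
    p * 1 * B₃.block 0 * (p * 4 * B₃.block 3)
      ≡⟨ regroup′ (B₃.block 0) (B₃.block 3) p ⟩
    B₃.block 0 * B₃.block 3 * (p * p * 4)
      ∎)
    where
    open ≡-Reasoning
    -- 3k + 1 runs through 6k + 1 and 6k + 4 = 2 (3k + 2)
    by-parity : prod (p * 2) B₃.term ≡ prod p B₆.term * (2 ^ p * prod p R₃.term)
    by-parity = begin
      prod (p * 2) B₃.term                                        ≡⟨ prod-blocks p 2 B₃.term ⟩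
      prod p (λ k → 1 * B₃.term (k * 2 + 0) * B₃.term (k * 2 + 1)) ≡⟨ prod-cong p (λ k _ → mod-6 k) ⟩
      prod p (λ k → B₆.term k * (2 * R₃.term k))                  ≡⟨ prod-* p B₆.term (λ k → 2 * R₃.term k) ⟩
      prod p B₆.term * prod p (λ k → 2 * R₃.term k)               ≡⟨ cong (prod p B₆.term *_) (prod-* p (λ _ → 2) R₃.term) ⟩
      prod p B₆.term * (prod p (λ _ → 2) * prod p R₃.term)        ≡⟨ cong (λ z → prod p B₆.term * (z * prod p R₃.term)) (prod-const p 2) ⟩
      prod p B₆.term * (2 ^ p * prod p R₃.term)                   ∎
      where
      mod-6 : ∀ k → 1 * (3 * (k * 2 + 0) + 1) * (3 * (k * 2 + 1) + 1) ≡ (6 * k + 1) * (2 * (3 * k + 2))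
      mod-6 = solve-∀
    by-halves : prod (p * 2) B₃.term ≡ prod p B₃.term * prod p (λ i → 3 * p + B₃.term i)
    by-halves = begin
      prod (p * 2) B₃.term                                   ≡⟨ cong (λ L → prod L B₃.term) (*-comm p 2) ⟩
      prod (p + (p + 0)) B₃.term                             ≡⟨ cong (λ L → prod (p + L) B₃.term) (+-identityʳ p) ⟩
      prod (p + p) B₃.term                                   ≡⟨ prod-+ p p B₃.term ⟩
      prod p B₃.term * prod p (λ i → B₃.term (p + i))        ≡⟨ cong (prod p B₃.term *_) (prod-cong p (λ i _ → shift p i)) ⟩
      prod p B₃.term * prod p (λ i → 3 * p + B₃.term i)      ∎
      where
      shift : ∀ p i → 3 * (p + i) + 1 ≡ 3 * p + (3 * i + 1)
      shift = solve-∀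
    regroup : ∀ c b r p → c * (b * r) * (p * p * 4) ≡ p * 1 * b * (2 * c * (p * 2 * r))
    regroup = solve-∀
    regroup′ : ∀ b₀ b₃ p → p * 1 * b₀ * (p * 4 * b₃) ≡ b₀ * b₃ * (p * p * 4)
    regroup′ = solve-∀

  -- Computing (3p)! in two ways:  3^(p-1) · B₃ · R₃ = C₁ · C₂.
  gauss₂ : 3 ^ (6 * b) * (B₃.block 0 * R₃.block 0) ≡ C.block 1 * C.block 2
  gauss₂ = *-cancelʳ-≡ _ _ (p * p * 6 * P) {{p*p*6*P≢0}} (begin
    3 ^ (6 * b) * (B₃.block 0 * R₃.block 0) * (p * p * 6 * P)
      ≡⟨ regroup (3 ^ (6 * b)) (B₃.block 0) (R₃.block 0) p P ⟩
    p * 1 * B₃.block 0 * (p * 2 * R₃.block 0 * (3 ^ p * P))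
      ≡⟨ cong₂ (λ u v → u * (v * (3 ^ p * P))) (B₃.segment 0) (R₃.segment 0) ⟨
    prod p B₃.term * (prod p R₃.term * (3 ^ p * P))
      ≡⟨ triple-factorial p ⟨
    prod (p * 3) suc
      ≡⟨ by-thirds ⟩
    P * (prod p (λ i → suc (1 * p + i)) * prod p (λ i → suc (2 * p + i)))
      ≡⟨ cong₂ (λ u v → P * (u * v)) (C.factorial-segment 1) (C.factorial-segment 2) ⟩
    P * (p * 2 * C.block 1 * (p * 3 * C.block 2))
      ≡⟨ regroup′ P (C.block 1) (C.block 2) p ⟩
    C.block 1 * C.block 2 * (p * p * 6 * P)
      ∎)
    where
    open ≡-Reasoning
    P : ℕ
    P = prod p suc
    p*p*6*P≢0 : NonZero (p * p * 6 * P)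
    p*p*6*P≢0 = m*n≢0 (p * p * 6) P {{_}} {{subst NonZero (n!≡prod p) (p !≢0)}}
    by-thirds : prod (p * 3) suc ≡ P * (prod p (λ i → suc (1 * p + i)) * prod p (λ i → suc (2 * p + i)))
    by-thirds = begin
      prod (p * 3) suc                                                  ≡⟨ cong (λ L → prod L suc) (split p) ⟩
      prod (p + (p + p)) suc                                            ≡⟨ prod-+ p (p + p) suc ⟩
      P * prod (p + p) (λ i → suc (p + i))                              ≡⟨ cong (P *_) (prod-+ p p (λ i → suc (p + i))) ⟩
      P * (prod p (λ i → suc (p + i)) * prod p (λ i → suc (p + (p + i))))
        ≡⟨ cong₂ (λ u v → P * (u * v)) (prod-cong p (λ i _ → offset₁ p i)) (prod-cong p (λ i _ → offset₂ p i)) ⟩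
      P * (prod p (λ i → suc (1 * p + i)) * prod p (λ i → suc (2 * p + i))) ∎
      where
      split : ∀ p → p * 3 ≡ p + (p + p)
      split = solve-∀
      offset₁ : ∀ p i → suc (p + i) ≡ suc (1 * p + i)
      offset₁ = solve-∀
      offset₂ : ∀ p i → suc (p + (p + i)) ≡ suc (2 * p + i)
      offset₂ = solve-∀
    regroup : ∀ c b r p q → c * (b * r) * (p * p * 6 * q) ≡ p * 1 * b * (p * 2 * r * (3 * c * q))
    regroup = solve-∀
    regroup′ : ∀ q c₁ c₂ p → q * (p * 2 * c₁ * (p * 3 * c₂)) ≡ c₁ * c₂ * (p * p * 6 * q)
    regroup′ = solve-∀

  -- The reflected block W = R₃(0) is prime to p, since it divides C₁ · C₂.
  W-unit : Prime p → p ∤ R₃.block 0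
  W-unit p-prime p∣W = ∤-* (C.block-unit p-prime 1) (C.block-unit p-prime 2)
    (subst (p ∣_) gauss₂ (∣-trans p∣W (∣n⇒∣m*n (3 ^ (6 * b)) (n∣m*n (B₃.block 0)))))
    where open PrimeDivisibility p-prime

  -- 6^(p-1) B₆(0) B₃(0) ≡ C₀² (mod p²), first multiplied by the unit W.
  key : Prime p → 6 ^ (6 * b) * (B₆.block 0 * B₃.block 0) ≈ C.block 0 * C.block 0 [mod p * p ]
  key p-prime = PrimeDivisibility.≈-cancel p-prime (W-unit p-prime) (begin
    6 ^ (6 * b) * (B₆.block 0 * B₃.block 0) * W          ≡⟨ cong (λ z → z * (B₆.block 0 * B₃.block 0) * W) (^-distribʳ-* (6 * b) 2 3) ⟩
    2 ^ (6 * b) * 3 ^ (6 * b) * (B₆.block 0 * B₃.block 0) * W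
                                                         ≡⟨ regroup (2 ^ (6 * b)) (3 ^ (6 * b)) (B₆.block 0) (B₃.block 0) W ⟩
    3 ^ (6 * b) * B₃.block 0 * (2 ^ (6 * b) * (B₆.block 0 * W))
                                                         ≡⟨ cong (3 ^ (6 * b) * B₃.block 0 *_) gauss₁ ⟩
    3 ^ (6 * b) * B₃.block 0 * (B₃.block 0 * B₃.block 3) ≈⟨ ≈-*ˡ (3 ^ (6 * b) * B₃.block 0) (≈-*-cong (≈-sym B₃.reflection) (B₃.periodic 3)) ⟩
    3 ^ (6 * b) * B₃.block 0 * (W * B₃.block 0)          ≡⟨ regroup′ (3 ^ (6 * b)) (B₃.block 0) W ⟩
    3 ^ (6 * b) * (B₃.block 0 * W) * B₃.block 0          ≡⟨ cong (_* B₃.block 0) gauss₂ ⟩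
    C.block 1 * C.block 2 * B₃.block 0                   ≈⟨ ≈-*-cong (≈-*-cong (C.periodic 1) (C.periodic 2)) (≈-sym B₃.reflection) ⟩
    C.block 0 * C.block 0 * W                            ∎)
    where
    open ≈-Reasoning (p * p)
    W : ℕ
    W = R₃.block 0
    regroup : ∀ u v x y w → u * v * (x * y) * w ≡ v * y * (u * (x * w))
    regroup = solve-∀
    regroup′ : ∀ c y w → c * y * (w * y) ≡ c * (y * w) * y
    regroup′ = solve-∀

  F₆ F₃ N D x y : ℕ → ℕ
  F₆ m = prod m B₆.term
  F₃ m = prod m B₃.term
  N m = 6 ^ m * (F₆ m * F₃ m)
  D m = m ! * m !
  x j = 6 ^ (6 * b) * (B₆.block (6 * j) * B₃.block (3 * j))
  y j = C.block (1 * j) * C.block (1 * j)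

  x≈y : Prime p → ∀ j → x j ≈ y j [mod p * p ]
  x≈y p-prime j = begin
    6 ^ (6 * b) * (B₆.block (6 * j) * B₃.block (3 * j))  ≈⟨ ≈-*ˡ (6 ^ (6 * b)) (≈-*-cong (B₆.periodic (6 * j)) (B₃.periodic (3 * j))) ⟩
    6 ^ (6 * b) * (B₆.block 0 * B₃.block 0)              ≈⟨ key p-prime ⟩
    C.block 0 * C.block 0                                ≈⟨ ≈-*-cong (C.periodic (1 * j)) (C.periodic (1 * j)) ⟨
    C.block (1 * j) * C.block (1 * j)                    ∎
    where open ≈-Reasoning (p * p)

  N-step : ∀ m → N m ∣ N (suc m)
  N-step m = divides (6 * (B₆.term m * B₃.term m)) (regroup (6 ^ m) (F₆ m) (F₃ m) (B₆.term m) (B₃.term m))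
    where
    regroup : ∀ c f g u v → 6 * c * (f * u * (g * v)) ≡ 6 * (u * v) * (c * (f * g))
    regroup = solve-∀

  D-step : ∀ m → D (suc m) ≡ D m * (suc m * suc m)
  D-step m = regroup (suc m) (m !)
    where
    regroup : ∀ k f → k * f * (k * f) ≡ f * f * (k * k)
    regroup = solve-∀

  t≐ : ∀ m → t m ≐ N m ÷ D m
  t≐ = ≐-sequence 6 5 2

  theorem-b : Prime p → ∀ n → t (n * p) ≡ t n [modpow p , 2 ]
  theorem-b p-prime = dwork t t≐
    where
    open DworkCongruence p-prime N D x y refl N-step D-step
           (scaled-blocks-* 6 B₆.blocks B₃.blocks) (blocks-* C.factorial-blocks C.factorial-blocks)
           (λ j → PrimeDivisibility.∤-* p-prime (C.block-unit p-prime (1 * j)) (C.block-unit p-prime (1 * j)))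
           (x≈y p-prime)

p≡d[p/d]+1 : ∀ p d-1 → p % suc d-1 ≡ 1 → p ≡ suc (suc d-1 * (p / suc d-1))
p≡d[p/d]+1 p d-1 p%d≡1 = begin
  p                        ≡⟨ m≡m%n+[m/n]*n p d ⟩
  p % d + p / d * d        ≡⟨ cong (_+ p / d * d) p%d≡1 ⟩
  suc (p / d * d)          ≡⟨ cong suc (*-comm (p / d) d) ⟩
  suc (d * (p / d))        ∎
  where
  open ≡-Reasoning
  d : ℕ
  d = suc d-1

theorem1p1 :
    ((p : ℕ) → Prime p → p % 4 ≡ 1 →
       (n : ℕ) → 1 ≤ n → s (n * p) ≡ s n [modpow p , 2 ])
    ×
    ((p : ℕ) → Prime p → p % 6 ≡ 1 →
       (n : ℕ) → 1 ≤ n → t (n * p) ≡ t n [modpow p , 2 ])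
theorem1p1 = part-a , part-b
  where
  part-a : (p : ℕ) → Prime p → p % 4 ≡ 1 → (n : ℕ) → 1 ≤ n → s (n * p) ≡ s n [modpow p , 2 ]
  part-a p p-prime p%4≡1 n _ =
    subst (λ q → s (n * q) ≡ s n [modpow q , 2 ]) (sym p≡4a+1)
          (PartA.theorem-a (p / 4) (subst Prime p≡4a+1 p-prime) n)
    where
    p≡4a+1 : p ≡ suc (4 * (p / 4))
    p≡4a+1 = p≡d[p/d]+1 p 3 p%4≡1

  part-b : (p : ℕ) → Prime p → p % 6 ≡ 1 → (n : ℕ) → 1 ≤ n → t (n * p) ≡ t n [modpow p , 2 ]
  part-b p p-prime p%6≡1 n _ =
    subst (λ q → t (n * q) ≡ t n [modpow q , 2 ]) (sym p≡6b+1)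
          (PartB.theorem-b (p / 6) (subst Prime p≡6b+1 p-prime) n)
    where
    p≡6b+1 : p ≡ suc (6 * (p / 6))
    p≡6b+1 = p≡d[p/d]+1 p 5 p%6≡1
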